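{- For any integer $k\geq 1$, $\chi_{\text{lid}}(P^k_{2k+2})=2k+2$.
   Context: For integers $k,\ell\ge 1$, $P^k_\ell$ is the graph with vertex set $\{v_1,\dots,v_\ell\}$ in which $v_i$ and $v_j$ ($i\neq j$) are adjacent iff $|i-j|\leq k$. For a vertex $u$, $N[u]$ is its closed neighborhood; for a coloring $c$ and vertex set $S$, $c(S)$ is the set of colors on $S$. A lid-coloring is a proper vertex-coloring $c$ such that for every edge $uv$ with $N[u]\neq N[v]$, $c(N[u])\neq c(N[v])$; $\chi_{\text{lid}}(G)$ is the minimum number of colors in a lid-coloring of $G$. -}

module Defs where

open import Data.Nat using (ℕ; _≤_; _<_; _+_; _*_; ∣_-_∣)
open import Data.Fin using (Fin; toℕ)
open import Data.Product using (_×_; ∃-syntax)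
open import Data.Sum using (_⊎_)
open import Relation.Binary.PropositionalEquality using (_≡_)
open import Relation.Nullary using (¬_)
open import Function.Bundles using (_⇔_)

-- The graph P^k_ℓ: vertices v_1..v_ℓ (here Fin ℓ, v_{i+1} ↦ i),
-- v_i ~ v_j iff i ≠ j and |i - j| ≤ k.
Pkl-adj : (k ℓ : ℕ) → Fin ℓ → Fin ℓ → Set
Pkl-adj k ℓ i j = ¬ (i ≡ j) × ∣ toℕ i - toℕ j ∣ ≤ k

module _ {n : ℕ} (Adj : Fin n → Fin n → Set) where

  InClosedNbhd : Fin n → Fin n → Set
  InClosedNbhd u w = w ≡ u ⊎ Adj u w

  SameClosedNbhd : Fin n → Fin n → Set
  SameClosedNbhd u v = (w : Fin n) → InClosedNbhd u w ⇔ InClosedNbhd v w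

  SameColourSet : {m : ℕ} → (Fin n → Fin m) → Fin n → Fin n → Set
  SameColourSet {m} c u v =
    (col : Fin m) →
      (∃[ w ] (InClosedNbhd u w × c w ≡ col)) ⇔ (∃[ w ] (InClosedNbhd v w × c w ≡ col))

  IsProper : {m : ℕ} → (Fin n → Fin m) → Set
  IsProper c = ∀ u v → Adj u v → ¬ (c u ≡ c v)

  IsLidColoring : {m : ℕ} → (Fin n → Fin m) → Set
  IsLidColoring c =
    IsProper c ×
    (∀ u v → Adj u v → ¬ SameClosedNbhd u v → ¬ SameColourSet c u v)

  HasLidColoring : ℕ → Set
  HasLidColoring m = ∃[ c ] (IsLidColoring {m} c)

  χlid≡ : ℕ → Set
  χlid≡ m = HasLidColoring m × (∀ m′ → m′ < m → ¬ HasLidColoring m′)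

module Submission where

-- Upper bound: in any loopless graph the identity colouring is a lid-colouring,
-- since with all colours distinct, c(N[u]) = c(N[v]) forces N[u] = N[v].
--
-- Lower bound: a colouring of P^k_{2k+2} with fewer colours repeats a colour on
-- two vertices i < j, which (being non-adjacent) satisfy i + k < j.  We then find
-- a consecutive pair p, p+1 whose closed neighbourhoods are distinct but differ
-- only by i on the side of p and by j on the side of p+1; since c(i) = c(j),
-- the two colour sets coincide, contradicting the lid condition.  The window is
-- p = i + k when i ≥ 1 (then N[p] = N[p+1] ∪ {i}), and p = j - k - 1 when i = 0
-- (then N[p+1] ⊆ N[p] ∪ {j}, and N[p] has nothing to the left of i).

open import Defs
open import Data.Nat using (ℕ; zero; suc; z≤n; s≤s; z<s; s≤s⁻¹; _≤_; _<_; _+_; _*_; ∣_-_∣; _<?_)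
open import Data.Nat.Properties hiding (_≟_)
open import Data.Fin using (Fin; toℕ; fromℕ<; _≟_)
open import Data.Fin.Properties using (toℕ-injective; toℕ-fromℕ<; toℕ<n; pigeonhole)
open import Data.Product using (_×_; _,_; proj₁; ∃-syntax)
open import Data.Sum using (_⊎_; inj₁; inj₂; [_,_]′) renaming (map to map-⊎)
open import Data.Empty using (⊥; ⊥-elim)
open import Relation.Nullary using (¬_; yes; no)
open import Relation.Binary.PropositionalEquality using (_≡_; _≢_; refl; sym; trans; cong; subst)
open import Function.Bundles using (mk⇔; Equivalence)

module _ {n : ℕ} (Adj : Fin n → Fin n → Set) where

  private
    N[_]∋_ : Fin n → Fin n → Set
    N[ u ]∋ w = InClosedNbhd Adj u w

  colourTransfer : ∀ {m} (c : Fin n → Fin m) {u v i j : Fin n} → c i ≡ c j → N[ v ]∋ j →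
                   (∀ w → N[ u ]∋ w → w ≡ i ⊎ N[ v ]∋ w) →
                   ∀ {col} → ∃[ w ] (N[ u ]∋ w × c w ≡ col) → ∃[ w ] (N[ v ]∋ w × c w ≡ col)
  colourTransfer c ci≡cj j∈Nv Nu⊆Nv+i (w , w∈Nu , refl) with Nu⊆Nv+i w w∈Nu
  ... | inj₁ refl = _ , j∈Nv , sym ci≡cj
  ... | inj₂ w∈Nv = w , w∈Nv , refl

  twinClash : ∀ {m} {c : Fin n → Fin m} → IsLidColoring Adj c → {u v i j : Fin n} →
              Adj u v → c i ≡ c j → N[ u ]∋ i → N[ v ]∋ j →
              (∀ w → N[ u ]∋ w → w ≡ i ⊎ N[ v ]∋ w) →
              (∀ w → N[ v ]∋ w → w ≡ j ⊎ N[ u ]∋ w) →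
              ¬ N[ v ]∋ i ⊎ ¬ N[ u ]∋ j → ⊥
  twinClash {c = c} (_ , lid) {u} {v} {i} {j} u~v ci≡cj i∈Nu j∈Nv Nu⊆Nv+i Nv⊆Nu+j separated =
    lid u v u~v distinct λ col →
      mk⇔ (colourTransfer c ci≡cj j∈Nv Nu⊆Nv+i) (colourTransfer c (sym ci≡cj) i∈Nu Nv⊆Nu+j)
    where
      distinct : ¬ SameClosedNbhd Adj u v
      distinct same = [ (λ i∉Nv → i∉Nv (Equivalence.to (same i) i∈Nu))
                      , (λ j∉Nu → j∉Nu (Equivalence.from (same j) j∈Nv)) ]′ separated

  identityIsLid : (∀ u v → Adj u v → u ≢ v) → IsLidColoring Adj (λ x → x)
  identityIsLid loopless = loopless , λ u v _ distinct sameColours →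
    distinct λ w → mk⇔ (viaColour (Equivalence.to (sameColours w)))
                       (viaColour (Equivalence.from (sameColours w)))
    where
      viaColour : ∀ {x y w} → (∃[ z ] (N[ x ]∋ z × z ≡ w) → ∃[ z ] (N[ y ]∋ z × z ≡ w)) →
                  N[ x ]∋ w → N[ y ]∋ w
      viaColour f w∈Nx with f (_ , w∈Nx , refl)
      ... | _ , w∈Ny , refl = w∈Ny

-- Near k a b: a and b are at distance at most k, stated without truncated
-- subtraction so that windows [p - k, p + k] can be shifted by plain arithmetic.

Near : ℕ → ℕ → ℕ → Set
Near k a b = a ≤ b + k × b ≤ a + k

dist≤⇒Near : ∀ {k} a b → ∣ a - b ∣ ≤ k → Near k a b
dist≤⇒Near zero    b       d≤k = z≤n , d≤k
dist≤⇒Near (suc a) zero    d≤k = d≤k , z≤n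
dist≤⇒Near (suc a) (suc b) d≤k with dist≤⇒Near a b d≤k
... | a≤b+k , b≤a+k = s≤s a≤b+k , s≤s b≤a+k

Near⇒dist≤ : ∀ {k} a b → Near k a b → ∣ a - b ∣ ≤ k
Near⇒dist≤ zero    b       (_ , b≤k)               = b≤k
Near⇒dist≤ (suc a) zero    (a<k , _)               = a<k
Near⇒dist≤ (suc a) (suc b) (s≤s a≤b+k , s≤s b≤a+k) = Near⇒dist≤ a b (a≤b+k , b≤a+k)

leftEdge : ∀ {k p w} → Near k p w → w + k ≡ p ⊎ Near k (suc p) w
leftEdge (p≤w+k , w≤p+k) with m≤n⇒m<n∨m≡n p≤w+k
... | inj₁ p<w+k = inj₂ (p<w+k , m≤n⇒m≤1+n w≤p+k)
... | inj₂ p≡w+k = inj₁ (sym p≡w+k)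

rightEdge : ∀ {k p w} → Near k (suc p) w → w ≡ suc (p + k) ⊎ Near k p w
rightEdge (p<w+k , w≤1+p+k) with m≤n⇒m<n∨m≡n w≤1+p+k
... | inj₁ w<1+p+k = inj₂ (<⇒≤ p<w+k , s≤s⁻¹ w<1+p+k)
... | inj₂ w≡1+p+k = inj₁ w≡1+p+k

module PathPower (k ℓ : ℕ) where

  Adj : Fin ℓ → Fin ℓ → Set
  Adj = Pkl-adj k ℓ

  inNbhd⇒Near : ∀ {u w p} → toℕ u ≡ p → InClosedNbhd Adj u w → Near k p (toℕ w)
  inNbhd⇒Near {u} refl (inj₁ refl)      = m≤m+n (toℕ u) k , m≤m+n (toℕ u) k
  inNbhd⇒Near     refl (inj₂ (_ , d≤k)) = dist≤⇒Near _ _ d≤k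

  Near⇒inNbhd : ∀ {u w p} → toℕ u ≡ p → Near k p (toℕ w) → InClosedNbhd Adj u w
  Near⇒inNbhd {u} {w} refl near with w ≟ u
  ... | yes w≡u = inj₁ w≡u
  ... | no  w≢u = inj₂ ((λ u≡w → w≢u (sym u≡w)) , Near⇒dist≤ _ _ near)

  consecutiveAdjacent : 1 ≤ k → ∀ {u v p} → toℕ u ≡ p → toℕ v ≡ suc p → Adj u v
  consecutiveAdjacent 1≤k {u} refl v≡1+u =
    (λ u≡v → 1+n≢n (trans (sym v≡1+u) (cong toℕ (sym u≡v))))
    , Near⇒dist≤ _ _ (subst (Near k (toℕ u)) (sym v≡1+u)
                        (m≤n⇒m≤1+n (m≤m+n (toℕ u) k) , subst (_≤ toℕ u + k) (+-comm (toℕ u) 1) (+-monoʳ-≤ (toℕ u) 1≤k)))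

  sameColourFar : ∀ {m} {c : Fin ℓ → Fin m} → IsProper Adj c →
                  ∀ {i j} → toℕ i < toℕ j → c i ≡ c j → toℕ i + k < toℕ j
  sameColourFar proper {i} {j} i<j ci≡cj with toℕ i + k <? toℕ j
  ... | yes far = far
  ... | no  near = ⊥-elim (proper i j i~j ci≡cj)
    where
      i~j : Adj i j
      i~j = (λ i≡j → <-irrefl (cong toℕ i≡j) i<j)
          , Near⇒dist≤ _ _ (≤-trans (<⇒≤ i<j) (m≤m+n _ k) , ≮⇒≥ near)

  windowClash : 1 ≤ k → ∀ {m} {c : Fin ℓ → Fin m} → IsLidColoring Adj c →
                ∀ {i j a b} → toℕ i ≡ a → toℕ j ≡ b → c i ≡ c j →
                (p : ℕ) → suc p < ℓ → Near k p a → Near k (suc p) b →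
                (∀ x → x + k ≡ p → x ≡ a) →
                (suc (p + k) < ℓ → suc (p + k) ≡ b) →
                ¬ Near k (suc p) a ⊎ ¬ Near k p b → ⊥
  windowClash 1≤k lid {i} {j} refl refl ci≡cj p 1+p<ℓ near-i near-j onlyLeft onlyRight separated =
    twinClash Adj lid (consecutiveAdjacent 1≤k u≡p v≡1+p) ci≡cj
      (Near⇒inNbhd u≡p near-i) (Near⇒inNbhd v≡1+p near-j) Nu⊆Nv+i Nv⊆Nu+j
      (map-⊎ (λ ¬near i∈Nv → ¬near (inNbhd⇒Near v≡1+p i∈Nv))
             (λ ¬near j∈Nu → ¬near (inNbhd⇒Near u≡p j∈Nu)) separated)
    where
      u v : Fin ℓ
      u = fromℕ< (<-trans (n<1+n p) 1+p<ℓ)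
      v = fromℕ< 1+p<ℓ
      u≡p : toℕ u ≡ p
      u≡p = toℕ-fromℕ< _
      v≡1+p : toℕ v ≡ suc p
      v≡1+p = toℕ-fromℕ< _

      Nu⊆Nv+i : ∀ w → InClosedNbhd Adj u w → w ≡ i ⊎ InClosedNbhd Adj v w
      Nu⊆Nv+i w w∈Nu with leftEdge (inNbhd⇒Near u≡p w∈Nu)
      ... | inj₁ w+k≡p = inj₁ (toℕ-injective (onlyLeft (toℕ w) w+k≡p))
      ... | inj₂ near  = inj₂ (Near⇒inNbhd v≡1+p near)

      Nv⊆Nu+j : ∀ w → InClosedNbhd Adj v w → w ≡ j ⊎ InClosedNbhd Adj u w
      Nv⊆Nu+j w w∈Nv with rightEdge (inNbhd⇒Near v≡1+p w∈Nv)
      ... | inj₁ w≡1+p+k = inj₁ (toℕ-injective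
                             (trans w≡1+p+k (onlyRight (subst (_< ℓ) w≡1+p+k (toℕ<n w)))))
      ... | inj₂ near    = inj₂ (Near⇒inNbhd u≡p near)

module Critical (k : ℕ) (1≤k : 1 ≤ k) where

  ℓ : ℕ
  ℓ = 2 * k + 2

  open PathPower k ℓ

  ℓ≡ : ℓ ≡ suc (suc (k + k))
  ℓ≡ = trans (+-comm (2 * k) 2) (cong (λ x → suc (suc (k + x))) (+-identityʳ k))

  belowℓ : ∀ {x} → x < ℓ → x ≤ suc (k + k)
  belowℓ {x} x<ℓ = s≤s⁻¹ (subst (x <_) ℓ≡ x<ℓ)

  clashFromFirst : ∀ {m} {c : Fin ℓ → Fin m} → IsLidColoring Adj c → ∀ {i j} →
                   toℕ i ≡ 0 → (p : ℕ) → toℕ j ≡ suc (p + k) → c i ≡ c j → ⊥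
  clashFromFirst lid {j = j} i≡0 p j≡1+p+k ci≡cj =
    windowClash 1≤k lid i≡0 j≡1+p+k ci≡cj p 1+p<ℓ (p≤k , z≤n)
      (s≤s (≤-trans (m≤m+n p k) (m≤m+n _ k)) , ≤-refl)
      (λ x x+k≡p → n≤0⇒n≡0 (+-cancelʳ-≤ k x 0 (subst (_≤ k) (sym x+k≡p) p≤k)))
      (λ _ → refl)
      (inj₂ (λ (_ , 1+p+k≤p+k) → 1+n≰n 1+p+k≤p+k))
    where
      j<ℓ : suc (p + k) < ℓ
      j<ℓ = subst (_< ℓ) j≡1+p+k (toℕ<n j)
      p≤k : p ≤ k
      p≤k = +-cancelʳ-≤ k p k (s≤s⁻¹ (belowℓ j<ℓ))
      1+p<ℓ : suc p < ℓ
      1+p<ℓ = ≤-trans (s≤s (s≤s (m≤m+n p k))) j<ℓ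

  clashFromLater : ∀ {m} {c : Fin ℓ → Fin m} → IsLidColoring Adj c → ∀ {i j} →
                   (a : ℕ) → toℕ i ≡ suc a → suc a + k < toℕ j → c i ≡ c j → ⊥
  clashFromLater lid {j = j} a i≡1+a far ci≡cj =
    windowClash 1≤k lid i≡1+a refl ci≡cj p (≤-trans (s≤s far) (toℕ<n j))
      (≤-refl , ≤-trans (m≤m+n _ k) (m≤m+n _ k))
      (≤-trans far (m≤m+n _ k) , ≤-trans (belowℓ (toℕ<n j)) (s≤s (+-monoˡ-≤ k (m≤n+m k (suc a)))))
      (λ x x+k≡p → +-cancelʳ-≡ k x (suc a) x+k≡p)
      (λ beyond → ⊥-elim (<⇒≱ (+-monoˡ-< k (m<n+m k {suc a} z<s)) (s≤s⁻¹ (belowℓ beyond))))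
      (inj₁ (λ (2+a+k≤1+a+k , _) → 1+n≰n 2+a+k≤1+a+k))
    where
      p : ℕ
      p = suc a + k

  noRepeatedColour : ∀ {m} {c : Fin ℓ → Fin m} → IsLidColoring Adj c →
                     ∀ {i j} → toℕ i < toℕ j → c i ≡ c j → ⊥
  noRepeatedColour lid {i} {j} i<j ci≡cj with toℕ i in i≡a | sameColourFar (proj₁ lid) i<j ci≡cj
  ... | zero  | far = let (p , k+1+p≡j) = m≤n⇒∃[o]m+o≡n far
                      in clashFromFirst lid i≡a p
                           (trans (sym k+1+p≡j) (cong suc (+-comm k p))) ci≡cj
  ... | suc a | far = clashFromLater lid a i≡a far ci≡cj

  lowerBound : ∀ m → m < ℓ → ¬ HasLidColoring Adj m
  lowerBound m m<ℓ (c , lid) with i , j , i<j , ci≡cj ← pigeonhole m<ℓ c =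
    noRepeatedColour lid i<j ci≡cj

mainTheorem15 : (k : ℕ) → 1 ≤ k → χlid≡ (Pkl-adj k (2 * k + 2)) (2 * k + 2)
mainTheorem15 k 1≤k =
  ((λ x → x) , identityIsLid (Pkl-adj k (2 * k + 2)) (λ _ _ u~v → proj₁ u~v)) ,
  Critical.lowerBound k 1≤k
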